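{- In the graceful game on the path $P_n$: Bob has a winning strategy for every $n\geq 4$ (whoever starts); for $n=3$ the player who starts the game has a winning strategy; and Alice has a winning strategy for $n\in\{1,2\}$ (whoever starts).
   Context: $P_n$ denotes the path on $n$ vertices. A graceful labeling of a graph $G$ with $m$ edges is an injective map $f\colon V(G)\to\{0,1,\dots,m\}$ such that the induced edge labels $|f(u)-f(v)|$, $uv\in E(G)$, are pairwise distinct. The graceful game on a simple graph $G$ with $m$ edges: two players, Alice and Bob, alternately choose a free (not yet labeled) vertex and assign to it a label from $\{0,1,\dots,m\}$ not yet used. An edge both of whose endpoints are labeled gets label $|f(u)-f(v)|$; a move is legal only if after it all edge labels are pairwise distinct. Alice wins if the whole graph ends up gracefully labeled; Bob wins if he can prevent this. Either player may be the first to move. -}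

module Defs where

open import Data.Nat using (ℕ; suc; _≤_; _∸_; ∣_-_∣)
open import Data.Fin using (Fin; toℕ; _≟_)
open import Data.Maybe using (Maybe; just; nothing)
open import Data.Product using (_×_; ∃; ∃-syntax; _,_)
open import Relation.Nullary using (¬_; yes; no)
open import Relation.Binary.PropositionalEquality using (_≡_)

PathEdge : ∀ {n} → Fin n → Fin n → Set
PathEdge i j = toℕ j ≡ suc (toℕ i)

-- number of edges of P_n (labels range over {0,…,m})
edges : ℕ → ℕ
edges n = n ∸ 1

-- a partial labeling (nothing = free vertex)
Labeling : ℕ → Set
Labeling n = Fin n → Maybe ℕ

emptyLab : ∀ {n} → Labeling n
emptyLab _ = nothing

update : ∀ {n} → Labeling n → Fin n → ℕ → Labeling n
update f v l w with w ≟ v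
... | yes _ = just l
... | no _  = f w

Used : ∀ {n} → Labeling n → ℕ → Set
Used f l = ∃[ v ] f v ≡ just l

Full : ∀ {n} → Labeling n → Set
Full f = ∀ v → ∃[ l ] f v ≡ just l

EdgeLabelsDistinct : ∀ {n} → Labeling n → Set
EdgeLabelsDistinct {n} f =
  ∀ (i j i' j' : Fin n) (a b a' b' : ℕ) →
  PathEdge i j → PathEdge i' j' →
  f i ≡ just a → f j ≡ just b → f i' ≡ just a' → f j' ≡ just b' →
  ∣ a - b ∣ ≡ ∣ a' - b' ∣ → i ≡ i'

Legal : ∀ {n} → Labeling n → Fin n → ℕ → Set
Legal {n} f v l =
  f v ≡ nothing × l ≤ edges n × ¬ Used f l × EdgeLabelsDistinct (update f v l)

data Player : Set where
  alice bob : Player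

data AliceWins {n : ℕ} : Labeling n → Player → Set where
  finished  : ∀ {f p} → Full f → AliceWins f p
  alice-move : ∀ {f} (v : Fin n) (l : ℕ) → Legal f v l →
               AliceWins (update f v l) bob → AliceWins f alice
  bob-move  : ∀ {f} → (∃[ v ] ∃[ l ] Legal f v l) →
              (∀ (v : Fin n) (l : ℕ) → Legal f v l → AliceWins (update f v l) alice) →
              AliceWins f bob

-- Bob (has a strategy that) wins from position f with player p to move:
-- the game gets stuck with some vertex unlabeled.
data BobWins {n : ℕ} : Labeling n → Player → Set where
  stuck      : ∀ {f p} → ¬ Full f → (∀ (v : Fin n) (l : ℕ) → ¬ Legal f v l) → BobWins f p
  alice-move : ∀ {f} → ¬ Full f →
               (∀ (v : Fin n) (l : ℕ) → Legal f v l → BobWins (update f v l) bob) →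
               BobWins f alice
  bob-move   : ∀ {f} (v : Fin n) (l : ℕ) → Legal f v l →
               BobWins (update f v l) alice → BobWins f bob

module Submission where

-- Bob's strategies rest on one observation: once no graceful labelling extends the position, every
-- legal move keeps it so and the path is never completely labelled (bob-wins-doomed). In a graceful
-- labelling of P_{m+1} the m edge labels are exactly 1, …, m (every-label-occurs, by pigeonhole), so
-- the labels 0 and m sit on adjacent vertices, and the edge labelled m - 1 joins 0 with m - 1 or m
-- with 1. Two local obstructions (ExtremeBlocked, PairBlocked) therefore doom a position. After a
-- criterion for legal moves (edges-distinct-after) and the mirror symmetry of the path
-- (bob-wins-mirror), Bob's strategies create such an obstruction within two of his own moves:
-- BobStarts (n ≥ 4, Bob first) and AliceStarts (n ≥ 7, Alice first). The remaining cases, n ≤ 3 and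
-- Alice first on n ∈ {4, 5, 6}, are settled by a game-tree search whose results are proofs
-- (bobSolve, aliceSolve), run by the type checker.

open import Defs
open import Data.Nat using (ℕ; zero; suc; _≤_; _<_; z≤n; s≤s; _∸_; ∣_-_∣; _+_)
import Data.Nat.Properties as ℕₚ
open import Data.Nat.Induction using (<-wellFounded)
open import Induction.WellFounded using (Acc; acc)
open import Data.Fin as Fin using (Fin; toℕ; fromℕ<; inject₁; opposite; punchOut)
  renaming (zero to fz; suc to fs)
import Data.Fin.Properties as Finₚ
open import Data.Maybe as Maybe using (Maybe; just; nothing; _<∣>_; from-just)
import Data.Maybe.Properties as Maybeₚ
open import Data.List using (List; []; _∷_)
open import Data.List.Relation.Unary.Any using (here; there)
open import Data.List.Relation.Unary.All using (All; []; _∷_)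
open import Data.List.Membership.Propositional using (_∈_)
open import Data.Product using (∃; ∃-syntax; _×_; _,_; proj₁; proj₂)
open import Data.Sum using (_⊎_; inj₁; inj₂)
open import Data.Empty using (⊥; ⊥-elim)
open import Data.Unit using (⊤; tt)
open import Function using (case_of_)
open import Relation.Nullary using (¬_; Dec; yes; no; ¬?)
open import Relation.Nullary.Decidable using (_×-dec_; _⊎-dec_; _→-dec_; map′; dec⇒maybe)
open import Relation.Binary.PropositionalEquality

module _ {n : ℕ} (f : Labeling n) (v : Fin n) (l : ℕ) where

  update-same : update f v l v ≡ just l
  update-same with v Fin.≟ v
  ... | yes _ = refl
  ... | no v≢v = ⊥-elim (v≢v refl)

  update-other : ∀ {w} → w ≢ v → update f v l w ≡ f w
  update-other {w} w≢v with w Fin.≟ v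
  ... | yes w≡v = ⊥-elim (w≢v w≡v)
  ... | no _ = refl

  update-cases : ∀ w {a} → update f v l w ≡ just a → (w ≡ v × a ≡ l) ⊎ (w ≢ v × f w ≡ just a)
  update-cases w eq with w Fin.≟ v
  ... | yes w≡v = inj₁ (w≡v , sym (Maybeₚ.just-injective eq))
  ... | no w≢v = inj₂ (w≢v , eq)

labels-differ : ∀ {n} {g : Labeling n} {r o a b} → g r ≡ just a → g o ≡ just b → a ≢ b → r ≢ o
labels-differ gr go a≢b refl = a≢b (Maybeₚ.just-injective (trans (sym gr) go))

_⊑_ : ∀ {n} → Labeling n → Labeling n → Set
f ⊑ g = ∀ v {l} → f v ≡ just l → g v ≡ just l

update-extends : ∀ {n} {f : Labeling n} {v} l → f v ≡ nothing → f ⊑ update f v l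
update-extends {f = f} {v} l fv≡nothing w fw with w Fin.≟ v
... | yes refl with () ← trans (sym fw) fv≡nothing
... | no _ = fw

Adjacent : ∀ {n} → Fin n → Fin n → Set
Adjacent u w = PathEdge u w ⊎ PathEdge w u

adjacent-sym : ∀ {n} {u w : Fin n} → Adjacent u w → Adjacent w u
adjacent-sym (inj₁ e) = inj₂ e
adjacent-sym (inj₂ e) = inj₁ e

adjacent? : ∀ {n} (u w : Fin n) → Dec (Adjacent u w)
adjacent? u w = (toℕ w ℕₚ.≟ suc (toℕ u)) ⊎-dec (toℕ u ℕₚ.≟ suc (toℕ w))

no-loop : ∀ {n} {i : Fin n} → ¬ PathEdge i i
no-loop e = ℕₚ.1+n≢n (sym e)

edge : ∀ {m} (k : Fin m) → PathEdge (inject₁ k) (fs k)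
edge k = cong suc (sym (Finₚ.toℕ-inject₁ k))

edge-view : ∀ {m} {i j : Fin (suc m)} → PathEdge i j → ∃[ k ] (i ≡ inject₁ k × j ≡ fs k)
edge-view {i = i} {fs k} e =
  k , Finₚ.toℕ-injective (trans (ℕₚ.suc-injective (sym e)) (sym (Finₚ.toℕ-inject₁ k))) , refl

record Good {n} (f : Labeling n) : Set where
  field
    in-range      : ∀ v {l} → f v ≡ just l → l ≤ edges n
    distinct      : ∀ u v {l} → f u ≡ just l → f v ≡ just l → u ≡ v
    edge-distinct : EdgeLabelsDistinct f
open Good

good-empty : ∀ {n} → Good (emptyLab {n})
good-empty = record { in-range = λ _ (); distinct = λ _ _ (); edge-distinct = λ _ _ _ _ _ _ _ _ _ _ () }

good-step : ∀ {n} {f : Labeling n} {v l} → Good f → Legal f v l → Good (update f v l)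
good-step {f = f} {v} {l} good (_ , l≤m , unused , distinct-edges) = record
  { in-range = in-range′ ; distinct = distinct′ ; edge-distinct = distinct-edges }
  where
  in-range′ : ∀ w {a} → update f v l w ≡ just a → a ≤ _
  in-range′ w eq with update-cases f v l w eq
  ... | inj₁ (_ , refl) = l≤m
  ... | inj₂ (_ , fw) = in-range good w fw
  distinct′ : ∀ u w {a} → update f v l u ≡ just a → update f v l w ≡ just a → u ≡ w
  distinct′ u w eu ew with update-cases f v l u eu | update-cases f v l w ew
  ... | inj₁ (refl , _)    | inj₁ (refl , _)    = refl
  ... | inj₁ (_ , refl)    | inj₂ (_ , fw)      = ⊥-elim (unused (_ , fw))
  ... | inj₂ (_ , fu)      | inj₁ (_ , refl)    = ⊥-elim (unused (_ , fu))
  ... | inj₂ (_ , fu)      | inj₂ (_ , fw)      = distinct good u w fu fw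

difference : Maybe ℕ → Maybe ℕ → Maybe ℕ
difference (just a) (just b) = just ∣ a - b ∣
difference _        _        = nothing

edgeLabel : ∀ {m} → Labeling (suc m) → Fin m → Maybe ℕ
edgeLabel f k = difference (f (inject₁ k)) (f (fs k))

Apart : Maybe ℕ → Maybe ℕ → Set
Apart (just s) (just t) = s ≢ t
Apart _        _        = ⊤

apart? : ∀ x y → Dec (Apart x y)
apart? (just s) (just t) = ¬? (s ℕₚ.≟ t)
apart? nothing  _        = yes tt
apart? (just _) nothing  = yes tt

-- EdgeLabelsDistinct, restated over edge indices, which makes it decidable.
EdgeLabelsApart : ∀ {m} → Labeling (suc m) → Set
EdgeLabelsApart f = ∀ k k' → k ≡ k' ⊎ Apart (edgeLabel f k) (edgeLabel f k')

edgeLabel-just : ∀ {m} (f : Labeling (suc m)) k {a b} →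
                 f (inject₁ k) ≡ just a → f (fs k) ≡ just b → edgeLabel f k ≡ just ∣ a - b ∣
edgeLabel-just f k p q rewrite p | q = refl

apart⇒distinct : ∀ {m} {f : Labeling (suc m)} → EdgeLabelsApart f → EdgeLabelsDistinct f
apart⇒distinct {f = f} apart i j i' j' a b a' b' e e' fi fj fi' fj' eq
  with edge-view e | edge-view e'
... | k , refl , refl | k' , refl , refl with apart k k'
...   | inj₁ refl = refl
...   | inj₂ k∥k' = ⊥-elim (subst₂ Apart (edgeLabel-just f k fi fj) (edgeLabel-just f k' fi' fj') k∥k' eq)

distinct⇒apart : ∀ {m} {f : Labeling (suc m)} → EdgeLabelsDistinct f → EdgeLabelsApart f
distinct⇒apart {f = f} distinct-edges k k' with k Fin.≟ k'
... | yes k≡k' = inj₁ k≡k'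
... | no k≢k' with f (inject₁ k) in p | f (fs k) in q | f (inject₁ k') in p' | f (fs k') in q'
...   | just a  | just b  | just a' | just b' = inj₂ λ eq →
          k≢k' (Finₚ.inject₁-injective (distinct-edges _ _ _ _ a b a' b' (edge k) (edge k') p q p' q' eq))
...   | nothing | _       | _       | _       = inj₂ tt
...   | just _  | nothing | _       | _       = inj₂ tt
...   | just _  | just _  | nothing | _       = inj₂ tt
...   | just _  | just _  | just _  | nothing = inj₂ tt

edgeLabelsDistinct? : ∀ {m} (f : Labeling (suc m)) → Dec (EdgeLabelsDistinct f)
edgeLabelsDistinct? f = map′ apart⇒distinct distinct⇒apart
  (Finₚ.all? λ k → Finₚ.all? λ k' → (k Fin.≟ k') ⊎-dec apart? (edgeLabel f k) (edgeLabel f k'))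

labelled? : ∀ {n} (f : Labeling n) v l → Dec (f v ≡ just l)
labelled? f v l = Maybeₚ.≡-dec ℕₚ._≟_ (f v) (just l)

used? : ∀ {n} (f : Labeling n) l → Dec (Used f l)
used? f l = Finₚ.any? λ w → labelled? f w l

legal? : ∀ {m} (f : Labeling (suc m)) v l → Dec (Legal f v l)
legal? {m} f v l =
  Maybeₚ.≡-dec ℕₚ._≟_ (f v) nothing ×-dec l ℕₚ.≤? m ×-dec ¬? (used? f l)
    ×-dec edgeLabelsDistinct? (update f v l)

fromℕ≤ : ∀ {m l} → l ≤ m → Fin (suc m)
fromℕ≤ l≤m = fromℕ< (s≤s l≤m)

toℕ-fromℕ≤ : ∀ {m l} (l≤m : l ≤ m) → toℕ (fromℕ≤ l≤m) ≡ l
toℕ-fromℕ≤ l≤m = Finₚ.toℕ-fromℕ< (s≤s l≤m)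

-- Whether any legal move exists; only labels l ≤ m need to be tried.
legal-move? : ∀ {m} (f : Labeling (suc m)) → Dec (∃[ v ] ∃[ l ] Legal f v l)
legal-move? {m} f = Finₚ.any? λ v →
  map′ (λ (i , lg) → toℕ i , lg)
       (λ (l , lg) → fromℕ≤ (proj₁ (proj₂ lg)) ,
                     subst (Legal f v) (sym (toℕ-fromℕ≤ (proj₁ (proj₂ lg)))) lg)
       (Finₚ.any? λ (i : Fin (suc m)) → legal? f v (toℕ i))

full? : ∀ {n} (f : Labeling n) → Dec (Full f)
full? f = Finₚ.all? λ v → labelled (f v)
  where
  labelled : (x : Maybe ℕ) → Dec (∃[ l ] x ≡ just l)
  labelled (just l) = yes (l , refl)
  labelled nothing  = no λ { (_ , ()) }

Doomed : ∀ {n} → Labeling n → Set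
Doomed f = ∀ g → f ⊑ g → Full g → Good g → ⊥

doomed-step : ∀ {n} {f : Labeling n} {v} l → Doomed f → f v ≡ nothing → Doomed (update f v l)
doomed-step l doomed fv g ext = doomed g λ w fw → ext w (update-extends l fv w fw)

doomed-not-full : ∀ {n} {f : Labeling n} → Good f → Doomed f → ¬ Full f
doomed-not-full {f = f} good doomed full = doomed f (λ _ fv → fv) full good

-- The number of free vertices, the measure that decreases with every move.
isFree : Maybe ℕ → ℕ
isFree nothing  = 1
isFree (just _) = 0

free# : ∀ {n} → Labeling n → ℕ
free# {zero}  f = 0
free# {suc n} f = isFree (f fz) + free# (λ i → f (fs i))

FewerFree : ∀ {n} → Labeling n → Labeling n → Set
FewerFree g f = ∀ w → isFree (g w) ≤ isFree (f w)

free#-mono : ∀ {n} {f g : Labeling n} → FewerFree g f → free# g ≤ free# f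
free#-mono {zero}  le = z≤n
free#-mono {suc n} le = ℕₚ.+-mono-≤ (le fz) (free#-mono (λ w → le (fs w)))

free#-strict : ∀ {n} {f g : Labeling n} v → FewerFree g f → isFree (g v) < isFree (f v) →
               free# g < free# f
free#-strict fz     le lt = ℕₚ.+-mono-<-≤ lt (free#-mono (λ w → le (fs w)))
free#-strict (fs v) le lt = ℕₚ.+-mono-≤-< (le fz) (free#-strict v (λ w → le (fs w)) lt)

free#-update : ∀ {n} (f : Labeling n) v l → f v ≡ nothing → free# (update f v l) < free# f
free#-update f v l fv = free#-strict v pointwise
  (subst₂ (λ x y → isFree x < isFree y) (sym (update-same f v l)) (sym fv) ℕₚ.≤-refl)
  where
  pointwise : FewerFree (update f v l) f
  pointwise w with w Fin.≟ v
  ... | yes _ = z≤n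
  ... | no _  = ℕₚ.≤-refl

-- From a good doomed position Bob wins, whoever moves: any play keeps the position doomed
-- and therefore never completes a graceful labelling.
bob-wins-doomed : ∀ {m} {f : Labeling (suc m)} p → Good f → Doomed f → BobWins f p
bob-wins-doomed {f = f} p good doomed = continue p good doomed (<-wellFounded (free# f))
  where
  continue : ∀ {f : Labeling _} p → Good f → Doomed f → Acc _<_ (free# f) → BobWins f p
  continue alice good doomed (acc smaller) =
    alice-move (doomed-not-full good doomed) λ v l lg →
      continue bob (good-step good lg) (doomed-step l doomed (proj₁ lg)) (smaller (free#-update _ v l (proj₁ lg)))
  continue {f} bob good doomed (acc smaller) with legal-move? f
  ... | yes (v , l , lg) = bob-move v l lg
          (continue alice (good-step good lg) (doomed-step l doomed (proj₁ lg)) (smaller (free#-update _ v l (proj₁ lg))))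
  ... | no none = stuck (doomed-not-full good doomed) λ v l lg → none (v , l , lg)

injective⇒onto : ∀ {m} (h : Fin m → Fin m) → (∀ i j → h i ≡ h j → i ≡ j) → ∀ t → ∃[ k ] h k ≡ t
injective⇒onto {suc m} h inj t with Finₚ.any? (λ k → h k Fin.≟ t)
... | yes hit = hit
... | no miss = ⊥-elim (collision (Finₚ.pigeonhole (ℕₚ.n<1+n m) (λ k → punchOut (avoids k))))
  where
  avoids : ∀ k → t ≢ h k
  avoids k t≡hk = miss (k , sym t≡hk)
  collision : (∃[ i ] ∃[ j ] (i Fin.< j × punchOut (avoids i) ≡ punchOut (avoids j))) → ⊥
  collision (i , j , i<j , eq) =
    Finₚ.<⇒≢ i<j (inj i j (Finₚ.punchOut-injective (avoids i) (avoids j) eq))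

-- A value a ∈ [1, m] as an element of Fin m (shifted down by one); used to count edge labels.
fromPositive : ∀ {a m} → 1 ≤ a → a ≤ m → Fin m
fromPositive {suc a} _ a<m = fromℕ< a<m

fromPositive-injective : ∀ {a b m} (1≤a : 1 ≤ a) (a≤m : a ≤ m) (1≤b : 1 ≤ b) (b≤m : b ≤ m) →
                         fromPositive 1≤a a≤m ≡ fromPositive 1≤b b≤m → a ≡ b
fromPositive-injective {suc a} {suc b} _ a<m _ b<m eq =
  cong suc (trans (sym (Finₚ.toℕ-fromℕ< a<m)) (trans (cong toℕ eq) (Finₚ.toℕ-fromℕ< b<m)))

difference-bounded : ∀ {a b m} → a ≤ m → b ≤ m → ∣ a - b ∣ ≤ m
difference-bounded {a} {b} a≤m b≤m = ℕₚ.≤-trans (ℕₚ.∣m-n∣≤m⊔n a b) (ℕₚ.⊔-lub a≤m b≤m)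

distance-from-top-injective : ∀ {m a b} → a ≤ m → b ≤ m → ∣ m - a ∣ ≡ ∣ m - b ∣ → a ≡ b
distance-from-top-injective a≤m b≤m eq = ℕₚ.∸-cancelˡ-≡ a≤m b≤m
  (trans (sym (ℕₚ.m≤n⇒∣n-m∣≡n∸m a≤m)) (trans eq (ℕₚ.m≤n⇒∣n-m∣≡n∸m b≤m)))

EdgeLabelled : ∀ {n} → Labeling n → ℕ → Set
EdgeLabelled g t = ∃[ i ] ∃[ j ] ∃[ a ] ∃[ b ] (PathEdge i j × g i ≡ just a × g j ≡ just b × ∣ a - b ∣ ≡ t)

-- In a graceful labelling of P_{m+1} the m edge labels are distinct values in [1, m],
-- hence every t ∈ [1, m] is an edge label.
every-label-occurs : ∀ {m} {g : Labeling (suc m)} → Full g → Good g →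
                     ∀ t → 1 ≤ t → t ≤ m → EdgeLabelled g t
every-label-occurs {m} {g} full good t 1≤t t≤m =
  inject₁ k , fs k , end (inject₁ k) , end (fs k) , edge k , labelled _ , labelled _ , label≡t
  where
  end : Fin (suc m) → ℕ
  end v = proj₁ (full v)
  labelled : ∀ v → g v ≡ just (end v)
  labelled v = proj₂ (full v)
  label : Fin m → ℕ
  label k = ∣ end (inject₁ k) - end (fs k) ∣
  positive : ∀ k → 1 ≤ label k
  positive k with label k in eq
  ... | suc _ = s≤s z≤n
  ... | zero = ⊥-elim (no-loop (subst (λ i → PathEdge i (fs k)) ends-equal (edge k)))
    where
    ends-equal : inject₁ k ≡ fs k
    ends-equal = distinct good _ _ (labelled (inject₁ k))
                   (subst (λ a → g (fs k) ≡ just a) (sym (ℕₚ.∣m-n∣≡0⇒m≡n eq)) (labelled (fs k)))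
  bounded : ∀ k → label k ≤ m
  bounded k = difference-bounded (in-range good _ (labelled _)) (in-range good _ (labelled _))
  code : Fin m → Fin m
  code k = fromPositive (positive k) (bounded k)
  code-injective : ∀ i j → code i ≡ code j → i ≡ j
  code-injective i j eq = Finₚ.inject₁-injective
    (edge-distinct good _ _ _ _ _ _ _ _ (edge i) (edge j) (labelled _) (labelled _) (labelled _) (labelled _)
       (fromPositive-injective (positive i) (bounded i) (positive j) (bounded j) eq))
  found : ∃[ k ] code k ≡ fromPositive 1≤t t≤m
  found = injective⇒onto code code-injective (fromPositive 1≤t t≤m)
  k : Fin m
  k = proj₁ found
  label≡t : label k ≡ t
  label≡t = fromPositive-injective (positive k) (bounded k) 1≤t t≤m (proj₂ found)

extreme-ends : ∀ {m a b} → a ≤ m → b ≤ m → ∣ a - b ∣ ≡ m → (a ≡ 0 × b ≡ m) ⊎ (a ≡ m × b ≡ 0)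
extreme-ends {a = zero}          _ _ d≡m = inj₁ (refl , d≡m)
extreme-ends {a = suc a} {zero}  _ _ d≡m = inj₂ (d≡m , refl)
extreme-ends {suc m} {suc a} {suc b} (s≤s a≤m) (s≤s b≤m) d≡m =
  ⊥-elim (ℕₚ.1+n≰n (subst (_≤ m) d≡m (difference-bounded a≤m b≤m)))

near-extreme-ends : ∀ {m a b} → a ≤ suc m → b ≤ suc m → ∣ a - b ∣ ≡ m →
  ((a ≡ 0 × b ≡ m) ⊎ (a ≡ m × b ≡ 0)) ⊎ ((a ≡ 1 × b ≡ suc m) ⊎ (a ≡ suc m × b ≡ 1))
near-extreme-ends {a = zero}         _ _ d≡m = inj₁ (inj₁ (refl , d≡m))
near-extreme-ends {a = suc a} {zero} _ _ d≡m = inj₁ (inj₂ (d≡m , refl))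
near-extreme-ends {a = suc a} {suc b} (s≤s a≤m) (s≤s b≤m) d≡m with extreme-ends a≤m b≤m d≡m
... | inj₁ (refl , refl) = inj₂ (inj₁ (refl , refl))
... | inj₂ (refl , refl) = inj₂ (inj₂ (refl , refl))

Extremes : ℕ → ℕ → ℕ → Set
Extremes m c p = (c ≡ 0 × p ≡ m) ⊎ (c ≡ m × p ≡ 0)

extremes-bounded : ∀ {m c p} → Extremes m c p → p ≤ m
extremes-bounded (inj₁ (_ , refl)) = ℕₚ.≤-refl
extremes-bounded (inj₂ (_ , refl)) = z≤n

extremes-differ : ∀ {m c p} → 1 ≤ m → Extremes m c p → p ≢ c
extremes-differ (s≤s z≤n) (inj₁ (refl , refl)) ()
extremes-differ (s≤s z≤n) (inj₂ (refl , refl)) ()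

-- In a graceful labelling of P_{m+1} the vertices labelled 0 and m are adjacent:
-- they are the ends of the edge labelled m.
extreme-partner : ∀ {m} {g : Labeling (suc m)} {u c p} → Full g → Good g → 1 ≤ m →
                  Extremes m c p → g u ≡ just c → ∃[ w ] (Adjacent u w × g w ≡ just p)
extreme-partner {m} full good 1≤m ex gu
  with every-label-occurs full good m 1≤m ℕₚ.≤-refl
... | i , j , a , b , e , gi , gj , d≡m with extreme-ends (in-range good _ gi) (in-range good _ gj) d≡m | ex
...   | inj₁ (refl , refl) | inj₁ (refl , refl) rewrite distinct good _ _ gu gi = j , inj₁ e , gj
...   | inj₁ (refl , refl) | inj₂ (refl , refl) rewrite distinct good _ _ gu gj = i , inj₂ e , gi
...   | inj₂ (refl , refl) | inj₁ (refl , refl) rewrite distinct good _ _ gu gj = i , inj₂ e , gi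
...   | inj₂ (refl , refl) | inj₂ (refl , refl) rewrite distinct good _ _ gu gi = j , inj₁ e , gj

second-edge : ∀ {m} {g : Labeling (suc (suc m))} → Full g → Good g → 1 ≤ m →
                  ∃[ x ] ∃[ y ] (Adjacent x y ×
                ((g x ≡ just 0 × g y ≡ just m) ⊎ (g x ≡ just (suc m) × g y ≡ just 1)))
second-edge {m} full good 1≤m with every-label-occurs full good m 1≤m (ℕₚ.n≤1+n m)
... | i , j , a , b , e , gi , gj , d≡m with near-extreme-ends (in-range good _ gi) (in-range good _ gj) d≡m
...   | inj₁ (inj₁ (refl , refl)) = i , j , inj₁ e , inj₁ (gi , gj)
...   | inj₁ (inj₂ (refl , refl)) = j , i , inj₂ e , inj₁ (gj , gi)
...   | inj₂ (inj₁ (refl , refl)) = j , i , inj₂ e , inj₂ (gj , gi)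
...   | inj₂ (inj₂ (refl , refl)) = i , j , inj₁ e , inj₂ (gi , gj)

Blocked : ∀ {n} → Labeling n → Fin n → ℕ → Set
Blocked f w p = (∃[ d ] (f w ≡ just d × d ≢ p)) ⊎ (∃[ z ] (f z ≡ just p × z ≢ w))

blocked-excludes : ∀ {n} {f g : Labeling n} {w p} → f ⊑ g → Good g → Blocked f w p → g w ≢ just p
blocked-excludes ext good (inj₁ (d , fw , d≢p)) gw = d≢p (Maybeₚ.just-injective (trans (sym (ext _ fw)) gw))
blocked-excludes ext good (inj₂ (z , z-has-p , z≢w)) gw = z≢w (distinct good _ _ (ext _ z-has-p) gw)

-- Vertex u carries an extreme label whose partner p can no longer be placed next to u,
-- so the edge labelled m can never appear.
ExtremeBlocked : ∀ {m} → Labeling (suc m) → Fin (suc m) → ℕ → Set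
ExtremeBlocked {m} f u p = ∃[ c ] (f u ≡ just c × Extremes m c p × (∀ w → Adjacent u w → Blocked f w p))

extremeBlocked-doomed : ∀ {m} {f : Labeling (suc m)} {u p} → 1 ≤ m → ExtremeBlocked f u p → Doomed f
extremeBlocked-doomed 1≤m (c , fu , ex , blocked) g ext full good
  with extreme-partner full good 1≤m ex (ext _ fu)
... | w , adj , gw = blocked-excludes ext good (blocked w adj) gw

-- s and t carry 0 and m+1, but no other neighbour of s can get m and no other neighbour of t can get 1,
-- so the edge labelled m can never appear.
PairBlocked : ∀ {m} → Labeling (suc (suc m)) → Fin (suc (suc m)) → Fin (suc (suc m)) → Set
PairBlocked {m} f s t = f s ≡ just 0 × f t ≡ just (suc m) ×
  (∀ r → Adjacent s r → r ≢ t → Blocked f r m) × (∀ r → Adjacent t r → r ≢ s → Blocked f r 1)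

pairBlocked-doomed : ∀ {m} {f : Labeling (suc (suc m))} {s t} → 1 ≤ m → PairBlocked f s t → Doomed f
pairBlocked-doomed {m} {s = s} {t} 1≤m (fs0 , ft , blocked-s , blocked-t) g ext full good
  with second-edge full good 1≤m
... | x , y , adj , inj₁ (gx , gy) rewrite distinct good _ _ gx (ext s fs0) =
  blocked-excludes ext good (blocked-s y adj (labels-differ gy (ext t ft) λ m≡1+m → ℕₚ.1+n≢n (sym m≡1+m))) gy
... | x , y , adj , inj₂ (gx , gy) rewrite distinct good _ _ gx (ext t ft) =
  blocked-excludes ext good (blocked-t y adj (labels-differ gy (ext s fs0) λ ())) gy

-- The position reached by a sequence of moves, listed most recent first.
play : ∀ {n} → List (Fin n × ℕ) → Labeling n
play []             = emptyLab
play ((v , l) ∷ ms) = update (play ms) v l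

placed : ∀ {n} (ms : List (Fin n × ℕ)) x {a} → play ms x ≡ just a → (x , a) ∈ ms
placed ((v , l) ∷ ms) x eq with update-cases (play ms) v l x eq
... | inj₁ (refl , refl) = here refl
... | inj₂ (_ , earlier) = there (placed ms x earlier)

fresh : ∀ {n} (ms : List (Fin n × ℕ)) {z} → All (λ (v , _) → z ≢ v) ms → play ms z ≡ nothing
fresh []             []          = refl
fresh ((v , l) ∷ ms) (z≢v ∷ z∉) = trans (update-other (play ms) v l z≢v) (fresh ms z∉)

left-unique : ∀ {n} {i i' j : Fin n} → PathEdge i j → PathEdge i' j → i ≡ i'
left-unique e e' = Finₚ.toℕ-injective (ℕₚ.suc-injective (trans (sym e) e'))

no-two-cycle : ∀ {n} {i j : Fin n} → PathEdge i j → PathEdge j i → ⊥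
no-two-cycle {i = i} e e' = ℕₚ.<⇒≢ (ℕₚ.m<n+m (toℕ i) {2} (s≤s z≤n)) (trans e' (cong suc e))

-- Labelling the free vertex v with l creates edges from v to its labelled neighbours.
-- Edge labels stay distinct when every new label avoids the old ones and the new ones are distinct.
NewVsOld : ∀ {n} → Labeling n → Fin n → ℕ → Set
NewVsOld f v l = ∀ u i j {a b c} → Adjacent v u → f u ≡ just a →
                 PathEdge i j → f i ≡ just b → f j ≡ just c → ∣ l - a ∣ ≢ ∣ b - c ∣

NewVsNew : ∀ {n} → Labeling n → Fin n → ℕ → Set
NewVsNew f v l = ∀ u u' {a a'} → Adjacent v u → Adjacent v u' → f u ≡ just a → f u' ≡ just a' →
                 ∣ l - a ∣ ≡ ∣ l - a' ∣ → u ≡ u'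

data EdgeAfter {n} (f : Labeling n) (v : Fin n) (l : ℕ) (i j : Fin n) (a b : ℕ) : Set where
  old      : f i ≡ just a → f j ≡ just b → EdgeAfter f v l i j a b
  new-left  : i ≡ v → a ≡ l → f j ≡ just b → EdgeAfter f v l i j a b
  new-right : j ≡ v → b ≡ l → f i ≡ just a → EdgeAfter f v l i j a b

edge-after : ∀ {n} (f : Labeling n) v l {i j a b} → PathEdge i j →
             update f v l i ≡ just a → update f v l j ≡ just b → EdgeAfter f v l i j a b
edge-after f v l {i} {j} e fi fj with update-cases f v l i fi | update-cases f v l j fj
... | inj₁ (refl , _)    | inj₁ (refl , _)    = ⊥-elim (no-loop e)
... | inj₁ (i≡v , a≡l)  | inj₂ (_ , fj′)      = new-left i≡v a≡l fj′
... | inj₂ (_ , fi′)     | inj₁ (j≡v , b≡l)   = new-right j≡v b≡l fi′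
... | inj₂ (_ , fi′)     | inj₂ (_ , fj′)      = old fi′ fj′

edges-distinct-after : ∀ {n} {f : Labeling n} {v l} → EdgeLabelsDistinct f →
                       NewVsOld f v l → NewVsNew f v l → EdgeLabelsDistinct (update f v l)
edges-distinct-after {f = f} {v} {l} distinct-edges new-old new-new i j i' j' a b a' b' e e' fi fj fi' fj' same
  with edge-after f v l e fi fj | edge-after f v l e' fi' fj'
... | old p q             | old p' q'             = distinct-edges i j i' j' a b a' b' e e' p q p' q' same
... | old p q             | new-left refl refl q'  = ⊥-elim (new-old j' i j (inj₁ e') q' e p q (sym same))
... | old p q             | new-right refl refl p' =
      ⊥-elim (new-old i' i j (inj₂ e') p' e p q (sym (trans same (ℕₚ.∣-∣-comm a' l))))
... | new-left refl refl q  | old p' q'           = ⊥-elim (new-old j i' j' (inj₁ e) q e' p' q' same)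
... | new-right refl refl p | old p' q'           =
      ⊥-elim (new-old i i' j' (inj₂ e) p e' p' q' (trans (ℕₚ.∣-∣-comm l a) same))
... | new-left i≡v _ _    | new-left i'≡v _ _    = trans i≡v (sym i'≡v)
... | new-right j≡v _ _   | new-right j'≡v _ _   = left-unique e (subst (PathEdge i') (trans j'≡v (sym j≡v)) e')
... | new-left refl refl q  | new-right refl refl p' =
      ⊥-elim (no-two-cycle e (subst (λ u → PathEdge u i) (sym j≡i') e'))
  where
  j≡i' : j ≡ i'
  j≡i' = new-new j i' (inj₁ e) (inj₂ e') q p' (trans same (ℕₚ.∣-∣-comm a' l))
... | new-right refl refl p | new-left refl refl q' =
      ⊥-elim (no-two-cycle e' (subst (λ u → PathEdge u i') (sym j'≡i) e))
  where
  j'≡i : j' ≡ i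
  j'≡i = new-new j' i (inj₁ e') (inj₂ e) q' p (sym (trans (ℕₚ.∣-∣-comm l a) same))

legal-move : ∀ {n} {f : Labeling n} {v l} → Good f → f v ≡ nothing → l ≤ edges n → ¬ Used f l →
             NewVsOld f v l → NewVsNew f v l → Legal f v l
legal-move good free l≤m unused new-old new-new =
  free , l≤m , unused , edges-distinct-after (edge-distinct good) new-old new-new

Isolated : ∀ {n} → Labeling n → Fin n → Set
Isolated f v = ∀ u {a} → Adjacent v u → f u ≡ just a → ⊥

NoEdges : ∀ {n} → Labeling n → Set
NoEdges f = ∀ i j {a b} → PathEdge i j → f i ≡ just a → f j ≡ just b → ⊥

isolated-move-legal : ∀ {n} {f : Labeling n} {v l} → Good f → f v ≡ nothing → l ≤ edges n → ¬ Used f l →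
                      Isolated f v → Legal f v l
isolated-move-legal good free l≤m unused isolated =
  legal-move good free l≤m unused (λ u _ _ adj fu _ _ _ _ → isolated u adj fu)
                                  (λ u _ adj _ fu _ _ → ⊥-elim (isolated u adj fu))

no-edges-new-vs-old : ∀ {n} {f : Labeling n} {v l} → NoEdges f → NewVsOld f v l
no-edges-new-vs-old no-edges _ i j _ _ e fi fj _ = no-edges i j e fi fj

Mirror : ∀ {n} → Labeling n → Labeling n → Set
Mirror g f = ∀ w → g w ≡ f (opposite w)

mirror-sym : ∀ {n} {f g : Labeling n} → Mirror g f → Mirror f g
mirror-sym {f = f} g≈f w = trans (cong f (sym (Finₚ.opposite-involutive w))) (sym (g≈f (opposite w)))

opposite-edge : ∀ {n} {i j : Fin n} → PathEdge i j → PathEdge (opposite j) (opposite i)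
opposite-edge {n} {i} {j} e = begin
  toℕ (opposite i)             ≡⟨ Finₚ.opposite-prop i ⟩
  n ∸ suc (toℕ i)              ≡⟨ ℕₚ.+-∸-assoc 1 (subst (λ k → suc k ≤ n) e (Finₚ.toℕ<n j)) ⟩
  suc (n ∸ suc (suc (toℕ i)))  ≡⟨ cong (λ k → suc (n ∸ suc k)) (sym e) ⟩
  suc (n ∸ suc (toℕ j))        ≡⟨ cong suc (sym (Finₚ.opposite-prop j)) ⟩
  suc (toℕ (opposite j))       ∎
  where open ≡-Reasoning

opposite-injective : ∀ {n} {i j : Fin n} → opposite i ≡ opposite j → i ≡ j
opposite-injective {i = i} {j} eq =
  trans (sym (Finₚ.opposite-involutive i)) (trans (cong opposite eq) (Finₚ.opposite-involutive j))

mirror-edges-distinct : ∀ {n} {f g : Labeling n} → Mirror g f → EdgeLabelsDistinct f → EdgeLabelsDistinct g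
mirror-edges-distinct {f = f} {g} g≈f distinct-edges i j i' j' a b a' b' e e' gi gj gi' gj' same =
  left-unique e (subst (PathEdge i') (sym (opposite-injective oj≡oj')) e')
  where
  at : ∀ {w c} → g w ≡ just c → f (opposite w) ≡ just c
  at {w} gw = trans (sym (g≈f w)) gw
  oj≡oj' : opposite j ≡ opposite j'
  oj≡oj' = distinct-edges _ _ _ _ b a b' a' (opposite-edge e) (opposite-edge e') (at gj) (at gi) (at gj') (at gi')
             (trans (ℕₚ.∣-∣-comm b a) (trans same (ℕₚ.∣-∣-comm a' b')))

mirror-full : ∀ {n} {f g : Labeling n} → Mirror g f → Full f → Full g
mirror-full g≈f full w = proj₁ (full (opposite w)) , trans (g≈f w) (proj₂ (full (opposite w)))

mirror-update : ∀ {n} {f g : Labeling n} → Mirror g f → ∀ v l → Mirror (update g (opposite v) l) (update f v l)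
mirror-update g≈f v l w with w Fin.≟ opposite v | opposite w Fin.≟ v
... | yes _    | yes _    = refl
... | no _     | no _     = g≈f w
... | yes refl | no ≢v    = ⊥-elim (≢v (Finₚ.opposite-involutive v))
... | no ≢ov   | yes refl = ⊥-elim (≢ov (sym (Finₚ.opposite-involutive w)))

mirror-legal : ∀ {n} {f g : Labeling n} {v l} → Mirror g f → Legal f v l → Legal g (opposite v) l
mirror-legal {f = f} {g} {v} {l} g≈f (free , l≤m , unused , distinct-edges) =
  trans (g≈f (opposite v)) (trans (cong f (Finₚ.opposite-involutive v)) free) , l≤m ,
  (λ (z , gz) → unused (opposite z , trans (sym (g≈f z)) gz)) ,
  mirror-edges-distinct (mirror-update g≈f v l) distinct-edges

bob-wins-mirror : ∀ {n} {f g : Labeling n} {p} → Mirror g f → BobWins f p → BobWins g p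
bob-wins-mirror g≈f (stuck ¬full none) =
  stuck (λ full → ¬full (mirror-full (mirror-sym g≈f) full))
        (λ v l lg → none (opposite v) l (mirror-legal (mirror-sym g≈f) lg))
bob-wins-mirror {f = f} {g} g≈f (alice-move ¬full respond) =
  alice-move (λ full → ¬full (mirror-full (mirror-sym g≈f) full)) λ v l lg →
    bob-wins-mirror (subst (λ w → Mirror (update g w l) (update f (opposite v) l)) (Finₚ.opposite-involutive v)
                           (mirror-update g≈f (opposite v) l))
                    (respond (opposite v) l (mirror-legal (mirror-sym g≈f) lg))
bob-wins-mirror g≈f (bob-move v l lg win) =
  bob-move (opposite v) l (mirror-legal g≈f lg) (bob-wins-mirror (mirror-update g≈f v l) win)

-- Game-tree search for the short paths. Every search returns a proof, so a search that succeeds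
-- (which the type checker confirms by evaluation) yields a winning strategy.
someFin : ∀ {k} {P : Fin k → Set} → (∀ i → Maybe (P i)) → Maybe (∃ P)
someFin {zero}  h = nothing
someFin {suc k} h = Maybe.map (fz ,_) (h fz) <∣> Maybe.map (λ (i , p) → fs i , p) (someFin (λ i → h (fs i)))

everyFin : ∀ {k} {P : Fin k → Set} → (∀ i → Maybe (P i)) → Maybe (∀ i → P i)
everyFin {zero}  h = just λ ()
everyFin {suc k} {P} h with h fz
... | nothing = nothing
... | just p₀ = Maybe.map extend (everyFin (λ i → h (fs i)))
  where
  extend : (∀ i → P (fs i)) → ∀ i → P i
  extend ps fz     = p₀
  extend ps (fs i) = ps i

someMove : ∀ {m} {P : Fin (suc m) → ℕ → Set} → (∀ v l → Maybe (P v l)) → Maybe (∃[ v ] ∃[ l ] P v l)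
someMove {m} h = Maybe.map (λ (v , i , p) → v , toℕ i , p)
                           (someFin λ v → someFin λ (i : Fin (suc m)) → h v (toℕ i))

everyLegalMove : ∀ {m} (f : Labeling (suc m)) {P : Fin (suc m) → ℕ → Set} →
                 (∀ v l → Legal f v l → Maybe (P v l)) → Maybe (∀ v l → Legal f v l → P v l)
everyLegalMove {m} f {P} h = Maybe.map extend (everyFin λ v → everyFin λ (i : Fin (suc m)) → try v (toℕ i))
  where
  try : ∀ v l → Maybe (Legal f v l → P v l)
  try v l with legal? f v l
  ... | yes lg = Maybe.map (λ p _ → p) (h v l lg)
  ... | no ¬lg = just λ lg → ⊥-elim (¬lg lg)
  extend : (∀ v (i : Fin (suc m)) → Legal f v (toℕ i) → P v (toℕ i)) → ∀ v l → Legal f v l → P v l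
  extend all v l lg = subst (λ x → Legal f v x → P v x) (toℕ-fromℕ≤ l≤m) (all v (fromℕ≤ l≤m)) lg
    where l≤m = proj₁ (proj₂ lg)

blocked? : ∀ {n} (f : Labeling n) w p → Dec (Blocked f w p)
blocked? f w p = relabelled (f w) ⊎-dec Finₚ.any? (λ z → labelled? f z p ×-dec ¬? (z Fin.≟ w))
  where
  relabelled : (x : Maybe ℕ) → Dec (∃[ d ] (x ≡ just d × d ≢ p))
  relabelled nothing  = no λ { (_ , () , _) }
  relabelled (just d) = map′ (λ d≢p → d , refl , d≢p) (λ { (_ , refl , d≢p) → d≢p }) (¬? (d ℕₚ.≟ p))

extremes? : ∀ m c → Maybe (∃[ p ] Extremes m c p)
extremes? m c with c ℕₚ.≟ 0 | c ℕₚ.≟ m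
... | yes c≡0 | _       = just (m , inj₁ (c≡0 , refl))
... | no _    | yes c≡m = just (0 , inj₂ (c≡m , refl))
... | no _    | no _    = nothing

extremeBlocked? : ∀ {m} (f : Labeling (suc m)) u → Maybe (∃[ p ] ExtremeBlocked f u p)
extremeBlocked? {m} f u with f u
... | nothing = nothing
... | just c with extremes? m c
...   | nothing = nothing
...   | just (p , ex) = Maybe.map (λ blocked → p , c , refl , ex , blocked)
                          (dec⇒maybe (Finₚ.all? λ w → adjacent? u w →-dec blocked? f w p))

pairBlocked? : ∀ {m} (f : Labeling (suc (suc m))) s t → Dec (PairBlocked f s t)
pairBlocked? {m} f s t =
  labelled? f s 0 ×-dec labelled? f t (suc m) ×-dec
  Finₚ.all? (λ r → adjacent? s r →-dec ¬? (r Fin.≟ t) →-dec blocked? f r m) ×-dec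
  Finₚ.all? (λ r → adjacent? t r →-dec ¬? (r Fin.≟ s) →-dec blocked? f r 1)

findObstruction : ∀ {m} (f : Labeling (suc (suc (suc m)))) → Maybe (Doomed f)
findObstruction f =
  Maybe.map (λ (_ , _ , eb) → extremeBlocked-doomed (s≤s z≤n) eb) (someFin (extremeBlocked? f)) <∣>
  Maybe.map (λ (_ , _ , pb) → pairBlocked-doomed (s≤s z≤n) pb)
            (someFin λ s → someFin λ t → dec⇒maybe (pairBlocked? f s t))

mutual
  bobSolve : ∀ {m} → ℕ → (f : Labeling (suc (suc (suc m)))) → Good f → ∀ p → Maybe (BobWins f p)
  bobSolve d f good p =
    Maybe.maybe′ (λ doomed → just (bob-wins-doomed p good doomed)) (bobSearch d f good p) (findObstruction f)

  bobSearch : ∀ {m} → ℕ → (f : Labeling (suc (suc (suc m)))) → Good f → ∀ p → Maybe (BobWins f p)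
  bobSearch zero    f good p = nothing
  bobSearch (suc d) f good alice with full? f
  ... | yes _ = nothing
  ... | no ¬full = Maybe.map (alice-move ¬full)
                     (everyLegalMove f λ v l lg → bobSolve d _ (good-step good lg) bob)
  bobSearch (suc d) f good bob =
    Maybe.map (λ (v , l , lg , win) → bob-move v l lg win) (someMove try)
    where
    try : ∀ v l → Maybe (∃[ lg ] BobWins (update f v l) alice)
    try v l with legal? f v l
    ... | yes lg = Maybe.map (lg ,_) (bobSolve d _ (good-step good lg) alice)
    ... | no _   = nothing

aliceSolve : ∀ {m} → ℕ → (f : Labeling (suc m)) → ∀ p → Maybe (AliceWins f p)
aliceSolve d f p with full? f
aliceSolve d       f p     | yes full = just (finished full)
aliceSolve zero    f p     | no _ = nothing
aliceSolve (suc d) f alice | no _ = Maybe.map (λ (v , l , lg , win) → alice-move v l lg win) (someMove try)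
  where
  try : ∀ v l → Maybe (∃[ lg ] AliceWins (update f v l) bob)
  try v l with legal? f v l
  ... | yes lg = Maybe.map (lg ,_) (aliceSolve d _ bob)
  ... | no _   = nothing
aliceSolve (suc d) f bob   | no _ with legal-move? f
... | yes some = Maybe.map (bob-move some) (everyLegalMove f λ v l _ → aliceSolve d _ alice)
... | no _     = nothing

adjacent-close : ∀ {n} {z u : Fin n} → Adjacent z u → toℕ z ≤ suc (toℕ u)
adjacent-close {z = z} (inj₁ e) =
  ℕₚ.≤-trans (ℕₚ.n≤1+n (toℕ z)) (ℕₚ.≤-trans (ℕₚ.≤-reflexive (sym e)) (ℕₚ.n≤1+n _))
adjacent-close         (inj₂ e) = ℕₚ.≤-reflexive e

Far : ∀ {n} → Fin n → Fin n → Set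
Far z u = suc (toℕ u) < toℕ z ⊎ suc (toℕ z) < toℕ u

-- Far vertices are neither adjacent nor equal; this is how Bob's moves are shown to avoid edges.
far⇒not-adjacent : ∀ {n} {z u : Fin n} → Far z u → ¬ Adjacent z u
far⇒not-adjacent (inj₁ u+1<z) adj = ℕₚ.<⇒≱ u+1<z (adjacent-close adj)
far⇒not-adjacent (inj₂ z+1<u) adj = ℕₚ.<⇒≱ z+1<u (adjacent-close (adjacent-sym adj))

far⇒≢ : ∀ {n} {z u : Fin n} → Far z u → z ≢ u
far⇒≢ {z = z} (inj₁ lt) refl = ℕₚ.<⇒≱ lt (ℕₚ.n≤1+n (toℕ z))
far⇒≢ {z = z} (inj₂ lt) refl = ℕₚ.<⇒≱ lt (ℕₚ.n≤1+n (toℕ z))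

far-from-0 : ∀ {n} {z : Fin (suc n)} → Far z fz → 2 ≤ toℕ z
far-from-0 (inj₁ 1<z) = 1<z

not-next-to-0 : ∀ {n} (z : Fin (suc n)) → 2 ≤ toℕ z → ¬ Adjacent z fz
not-next-to-0 _ 2≤z = far⇒not-adjacent (inj₁ 2≤z)

at-least-2⇒≢0 : ∀ {n} {z : Fin (suc (suc n))} → 2 ≤ toℕ z → z ≢ fz
at-least-2⇒≢0 () refl

at-least-2⇒≢1 : ∀ {n} {z : Fin (suc (suc n))} → 2 ≤ toℕ z → z ≢ fs fz
at-least-2⇒≢1 (s≤s ()) refl

neighbour-of-0 : ∀ {n} {w : Fin (suc (suc n))} → Adjacent fz w → w ≡ fs fz
neighbour-of-0 (inj₁ e) = Finₚ.toℕ-injective e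

neighbour-of-1 : ∀ {n} {w : Fin (suc (suc (suc n)))} → Adjacent (fs fz) w → w ≡ fz ⊎ w ≡ fs (fs fz)
neighbour-of-1 {w = fz}             _        = inj₁ refl
neighbour-of-1 {w = fs (fs fz)}     _        = inj₂ refl
neighbour-of-1 {w = fs fz}          (inj₁ ())
neighbour-of-1 {w = fs fz}          (inj₂ ())
neighbour-of-1 {w = fs (fs (fs _))} (inj₁ ())
neighbour-of-1 {w = fs (fs (fs _))} (inj₂ ())

-- If vertex 0 carries 0 and vertex 1 cannot receive m, no edge can be labelled m.
end-blocked-doomed : ∀ {m} {f : Labeling (suc (suc m))} → f fz ≡ just 0 → Blocked f (fs fz) (suc m) → Doomed f
end-blocked-doomed {f = f} f₀ blocked = extremeBlocked-doomed (s≤s z≤n)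
  (0 , f₀ , inj₁ (refl , refl) , λ w adj → subst (λ u → Blocked f u _) (sym (neighbour-of-0 adj)) blocked)

-- Bob's closing move: with 0 at vertex 0, Bob wins by legally placing m at a vertex z ∉ {0, 1}.
close-top : ∀ {m} {f : Labeling (suc (suc m))} {z} → Good f → f fz ≡ just 0 → 2 ≤ toℕ z →
            Legal f z (suc m) → BobWins f bob
close-top {m} {f} {z} good f₀ 2≤z lg = bob-move z (suc m) lg
  (bob-wins-doomed alice (good-step good lg)
    (end-blocked-doomed (trans (update-other f z (suc m) (λ 0≡z → at-least-2⇒≢0 2≤z (sym 0≡z))) f₀)
                        (inj₂ (z , update-same f z (suc m) , at-least-2⇒≢1 2≤z))))

-- A vertex at position at least 2 other than W = w + 2: vertex 2, or vertex 3 when W is vertex 2.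
spot : ∀ {k} → Fin (suc (suc k)) → Fin (suc (suc (suc (suc k))))
spot fz     = fs (fs (fs fz))
spot (fs _) = fs (fs fz)

2≤spot : ∀ {k} (w : Fin (suc (suc k))) → 2 ≤ toℕ (spot w)
2≤spot fz     = s≤s (s≤s z≤n)
2≤spot (fs _) = s≤s (s≤s z≤n)

spot≢ : ∀ {k} (w : Fin (suc (suc k))) → spot w ≢ fs (fs w)
spot≢ fz     ()
spot≢ (fs _) ()

-- Bob starts on P_{m+1} with m = K + 3 edges: he labels vertex 0 with 0. The edge labelled m must then
-- join vertex 0 to vertex 1, labelled m. Bob makes this impossible, or, if Alice labels vertex 1 with m
-- herself, makes the edge labelled m - 1 impossible instead.
module BobStarts (K : ℕ) where

  m : ℕ
  m = suc (suc (suc K))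

  position : List (Fin (suc m) × ℕ) → Labeling (suc m)
  position = play

  opening-legal : Legal (emptyLab {suc m}) fz 0
  opening-legal = isolated-move-legal good-empty refl z≤n (λ { (_ , ()) }) λ _ _ ()

  good-opening : Good (position ((fz , 0) ∷ []))
  good-opening = good-step good-empty opening-legal

  -- Alice labelled vertex 1 with m. Bob puts 2 on vertex 2; then vertex 1 has no neighbour
  -- left for label 1 and vertex 0 none for label m - 1, so no edge can be labelled m - 1.
  top-edge-answer : Good (position ((fs fz , m) ∷ (fz , 0) ∷ [])) →
                    BobWins (position ((fs fz , m) ∷ (fz , 0) ∷ [])) bob
  top-edge-answer good = bob-move (fs (fs fz)) 2 legal (bob-wins-doomed alice (good-step good legal) doomed)
    where
    moves : List (Fin (suc m) × ℕ)
    moves = (fs fz , m) ∷ (fz , 0) ∷ []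
    legal : Legal (position moves) (fs (fs fz)) 2
    legal = legal-move good refl (s≤s (s≤s z≤n)) unused new-old new-new
      where
      unused : ¬ Used (position moves) 2
      unused (w , eq) with placed moves w eq
      ... | here ()
      ... | there (here ())
      new-old : NewVsOld (position moves) (fs (fs fz)) 2
      new-old u i j adj pu e pi pj with placed moves u pu | placed moves i pi | placed moves j pj
      ... | there (here refl) | _                 | _                 = case adj of λ { (inj₁ ()) ; (inj₂ ()) }
      ... | here refl         | there (here refl) | here refl         = λ ()
      ... | here refl         | here refl         | here refl         = case e of λ ()
      ... | here refl         | there (here refl) | there (here refl) = case e of λ ()
      ... | here refl         | here refl         | there (here refl) = case e of λ ()
      new-new : NewVsNew (position moves) (fs (fs fz)) 2
      new-new u u' adj adj' pu pu' _ with placed moves u pu | placed moves u' pu'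
      ... | here refl         | here refl         = refl
      ... | there (here refl) | _                 = case adj of λ { (inj₁ ()) ; (inj₂ ()) }
      ... | _                 | there (here refl) = case adj' of λ { (inj₁ ()) ; (inj₂ ()) }
    doomed : Doomed (update (position moves) (fs (fs fz)) 2)
    doomed = pairBlocked-doomed {m = suc (suc K)} (s≤s z≤n)
      (refl , refl , (λ r adj r≢1 → ⊥-elim (r≢1 (neighbour-of-0 adj))) , vertex-2-blocked)
      where
      vertex-2-blocked : ∀ r → Adjacent (fs fz) r → r ≢ fz → Blocked (update (position moves) (fs (fs fz)) 2) r 1
      vertex-2-blocked r adj r≢0 with neighbour-of-1 adj
      ... | inj₁ r≡0  = ⊥-elim (r≢0 r≡0)
      ... | inj₂ refl = inj₁ (2 , refl , λ ())

  -- Alice labelled a vertex W = w + 2 with y ≠ m. Bob places m at 'spot w', which is neither W nor next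
  -- to vertex 0; its only possible labelled neighbour is W.
  far-answer : ∀ w {y} → y ≢ m → Good (position ((fs (fs w) , y) ∷ (fz , 0) ∷ [])) →
               BobWins (position ((fs (fs w) , y) ∷ (fz , 0) ∷ [])) bob
  far-answer w {y} y≢m good = close-top good refl (2≤spot w)
    (legal-move good (fresh moves (spot≢ w ∷ at-least-2⇒≢0 (2≤spot w) ∷ [])) ℕₚ.≤-refl
                unused (no-edges-new-vs-old {l = m} no-edges) new-new)
    where
    moves : List (Fin (suc m) × ℕ)
    moves = (fs (fs w) , y) ∷ (fz , 0) ∷ []
    unused : ¬ Used (position moves) m
    unused (u , eq) with placed moves u eq
    ... | here refl = y≢m refl
    ... | there (here ())
    no-edges : NoEdges (position moves)
    no-edges i j e pi pj with placed moves i pi | placed moves j pj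
    ... | here refl         | here refl         = no-loop e
    ... | there (here refl) | there (here refl) = case e of λ ()
    ... | here refl         | there (here refl) = case e of λ ()
    ... | there (here refl) | here refl         = case e of λ ()
    new-new : NewVsNew (position moves) (spot w) m
    new-new u u' adj adj' pu pu' _ with placed moves u pu | placed moves u' pu'
    ... | here refl         | here refl         = refl
    ... | there (here refl) | _                 = ⊥-elim (not-next-to-0 (spot w) (2≤spot w) adj)
    ... | _                 | there (here refl) = ⊥-elim (not-next-to-0 (spot w) (2≤spot w) adj')

  answer : ∀ w y → Legal (position ((fz , 0) ∷ [])) w y → BobWins (update (position ((fz , 0) ∷ [])) w y) bob
  answer fz y (() , _)
  answer (fs fz) y lg with y ℕₚ.≟ m
  ... | yes refl = top-edge-answer (good-step good-opening lg)
  ... | no y≢m   = bob-wins-doomed bob (good-step good-opening lg) (end-blocked-doomed refl (inj₁ (y , refl , y≢m)))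
  answer (fs (fs w)) y lg with y ℕₚ.≟ m
  ... | yes refl = bob-wins-doomed bob (good-step good-opening lg)
                     (end-blocked-doomed refl (inj₂ (fs (fs w) , update-same _ (fs (fs w)) m , λ ())))
  ... | no y≢m   = far-answer w y≢m (good-step good-opening lg)

  bob-wins-starting : BobWins {suc m} emptyLab bob
  bob-wins-starting = bob-move fz 0 opening-legal (alice-move (λ full → case proj₂ (full (fs fz)) of λ ()) answer)

-- Alice starts on P_{m+1} with m = K + 6 edges and labels v with x; by reflection v lies in the right
-- half, so v ≥ 3. If x is 0 or m, Bob puts its partner two steps left of v, leaving v without a partner
-- neighbour. Otherwise Bob puts 0 on vertex 0 and answers Alice's next move as when he starts: vertex 1
-- must get m, and Bob either spoils this or, if Alice plays it, spoils the edge labelled m - 1.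
module AliceStarts (K : ℕ) where

  m : ℕ
  m = suc (suc (suc (suc (suc (suc K)))))

  position : List (Fin (suc m) × ℕ) → Labeling (suc m)
  position = play

  first-move-good : ∀ v {x} → x ≤ m → Good (position ((v , x) ∷ []))
  first-move-good v x≤m = good-step good-empty (isolated-move-legal good-empty refl x≤m (λ { (_ , ()) }) λ _ _ ())

  two-plus : ∀ {t} → 2 ≤ t → ∃[ b ] t ≡ suc (suc b)
  two-plus (s≤s (s≤s {n = b} _)) = b , refl

  -- Alice put an extreme label x on v = b + 2. Bob puts the partner label p on vertex b, which is not
  -- next to v; then no neighbour of v can receive p.
  extreme-answer : ∀ v {x p} → 2 ≤ toℕ v → Extremes m x p → Good (position ((v , x) ∷ [])) →
                   BobWins (position ((v , x) ∷ [])) bob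
  extreme-answer v {x} {p} 2≤v ex good = bob-move z p legal (bob-wins-doomed alice (good-step good legal) doomed)
    where
    b : ℕ
    b = proj₁ (two-plus 2≤v)
    v≡b+2 : toℕ v ≡ suc (suc b)
    v≡b+2 = proj₂ (two-plus 2≤v)
    moves : List (Fin (suc m) × ℕ)
    moves = (v , x) ∷ []
    b≤m : b ≤ m
    b≤m = ℕₚ.≤-trans (ℕₚ.m≤n+m b 2) (subst (_≤ m) v≡b+2 (ℕₚ.≤-pred (Finₚ.toℕ<n v)))
    z : Fin (suc m)
    z = fromℕ≤ b≤m
    z-far : Far z v
    z-far = inj₂ (ℕₚ.≤-reflexive (trans (cong (λ k → suc (suc k)) (toℕ-fromℕ≤ b≤m)) (sym v≡b+2)))
    z≢v : z ≢ v
    z≢v = far⇒≢ z-far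
    legal : Legal (position moves) z p
    legal = isolated-move-legal good (fresh moves (z≢v ∷ [])) (extremes-bounded ex) unused isolated
      where
      unused : ¬ Used (position moves) p
      unused (u , eq) with placed moves u eq
      ... | here refl = extremes-differ (s≤s z≤n) ex refl
      isolated : Isolated (position moves) z
      isolated u adj pu with placed moves u pu
      ... | here refl = far⇒not-adjacent z-far adj
    doomed : Doomed (update (position moves) z p)
    doomed = extremeBlocked-doomed (s≤s z≤n)
      (x , trans (update-other _ z p (λ v≡z → z≢v (sym v≡z))) (update-same emptyLab v x) , ex ,
       λ w adj → inj₂ (z , update-same _ z p , λ { refl → far⇒not-adjacent z-far (adjacent-sym adj) }))

  -- Label 2 on vertex 2 keeps the new edges to labels m and x apart, unless x = 2.
  two-apart : ∀ x → 1 ≤ x → x < m → x ≢ 2 → ∣ 2 - m ∣ ≢ ∣ 2 - x ∣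
  two-apart 1                   _ _   _   ()
  two-apart 2                   _ _   x≢2 _  = x≢2 refl
  two-apart (suc (suc (suc x))) _ x<m _   eq =
    ℕₚ.1+n≰n (subst (λ y → suc (suc (suc (suc y))) ≤ m) (sym (ℕₚ.suc-injective eq)) x<m)

  -- Alice put a label 0 < x < m on a vertex v ≥ 3. Bob puts 0 on vertex 0, so that the edge labelled m
  -- would have to join vertex 0 to vertex 1 labelled m.
  module Middle (v : Fin (suc m)) (x : ℕ) (3≤v : 3 ≤ toℕ v) (1≤x : 1 ≤ x) (x<m : x < m)
                (good₁ : Good (position ((v , x) ∷ []))) where

    v≢ : ∀ {u} → toℕ u < 3 → v ≢ u
    v≢ u<3 refl = ℕₚ.<⇒≱ u<3 3≤v

    v≢0 : v ≢ fz
    v≢0 = v≢ (s≤s z≤n)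

    v≢1 : v ≢ fs fz
    v≢1 = v≢ (s≤s (s≤s z≤n))

    v≢2 : v ≢ fs (fs fz)
    v≢2 = v≢ (s≤s (s≤s (s≤s z≤n)))

    opening : List (Fin (suc m) × ℕ)
    opening = (fz , 0) ∷ (v , x) ∷ []

    opening-legal : Legal (position ((v , x) ∷ [])) fz 0
    opening-legal = isolated-move-legal good₁ (fresh _ ((λ 0≡v → v≢0 (sym 0≡v)) ∷ [])) z≤n unused isolated
      where
      unused : ¬ Used (position ((v , x) ∷ [])) 0
      unused (u , eq) with placed ((v , x) ∷ []) u eq
      ... | here refl = case 1≤x of λ ()
      isolated : Isolated (position ((v , x) ∷ [])) fz
      isolated u adj pu with placed ((v , x) ∷ []) u pu
      ... | here refl = v≢1 (neighbour-of-0 adj)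

    good₂ : Good (position opening)
    good₂ = good-step good₁ opening-legal

    -- Alice labelled vertex 1 with m. Bob puts d ∈ {2, 3}, d ≠ x, on vertex 2: then vertex 1 has no
    -- neighbour left for label 1 and vertex 0 none for m - 1, so no edge can be labelled m - 1.
    module SecondEdge (d : ℕ) (2≤d : 2 ≤ d) (d≤3 : d ≤ 3) (d≢x : d ≢ x)
                      (apart : ∣ d - m ∣ ≢ ∣ d - x ∣) where

      moves : List (Fin (suc m) × ℕ)
      moves = (fs fz , m) ∷ opening

      d<m : d < m
      d<m = ℕₚ.≤-trans (s≤s d≤3) (s≤s (s≤s (s≤s (s≤s z≤n))))

      only-edge : ∀ i j {b c} → PathEdge i j → position moves i ≡ just b → position moves j ≡ just c →
                  b ≡ 0 × c ≡ m
      only-edge i j e pi pj with placed moves i pi | placed moves j pj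
      ... | there (here refl)         | here refl                 = refl , refl
      ... | here refl                 | here refl                 = case e of λ ()
      ... | here refl                 | there (here refl)         = case e of λ ()
      ... | here refl                 | there (there (here refl)) = ⊥-elim (v≢2 (Finₚ.toℕ-injective e))
      ... | there (here refl)         | there (here refl)         = case e of λ ()
      ... | there (here refl)         | there (there (here refl)) = ⊥-elim (v≢1 (Finₚ.toℕ-injective e))
      ... | there (there (here refl)) | here refl                 = ⊥-elim (v≢0 (Finₚ.toℕ-injective (ℕₚ.suc-injective (sym e))))
      ... | there (there (here refl)) | there (here refl)         = case e of λ ()
      ... | there (there (here refl)) | there (there (here refl)) = ⊥-elim (no-loop e)

      not-extreme : ∀ {a} → a ≤ m → a ≢ 0 → d ≢ 0 → ∣ d - a ∣ ≢ m
      not-extreme a≤m a≢0 d≢0 eq with extreme-ends (ℕₚ.<⇒≤ d<m) a≤m eq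
      ... | inj₁ (d≡0 , _)   = d≢0 d≡0
      ... | inj₂ (_ , a≡0)   = a≢0 a≡0

      d≢0 : d ≢ 0
      d≢0 refl = case 2≤d of λ ()

      legal : Good (position moves) → Legal (position moves) (fs (fs fz)) d
      legal good = legal-move good (fresh moves ((λ ()) ∷ (λ ()) ∷ (λ 2≡v → v≢2 (sym 2≡v)) ∷ []))
                              (ℕₚ.<⇒≤ d<m) unused new-old new-new
        where
        unused : ¬ Used (position moves) d
        unused (u , eq) with placed moves u eq
        ... | here refl                 = ℕₚ.<-irrefl refl d<m
        ... | there (here refl)         = d≢0 refl
        ... | there (there (here refl)) = d≢x refl
        new-old : NewVsOld (position moves) (fs (fs fz)) d
        new-old u i j adj pu e pi pj with only-edge i j e pi pj | placed moves u pu
        ... | refl , refl | here refl                 = not-extreme ℕₚ.≤-refl (λ ()) d≢0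
        ... | refl , refl | there (here refl)         = case adj of λ { (inj₁ ()) ; (inj₂ ()) }
        ... | refl , refl | there (there (here refl)) = not-extreme (ℕₚ.<⇒≤ x<m) (λ { refl → case 1≤x of λ () }) d≢0
        new-new : NewVsNew (position moves) (fs (fs fz)) d
        new-new u u' adj adj' pu pu' eq with placed moves u pu | placed moves u' pu'
        ... | here refl                 | here refl                 = refl
        ... | there (there (here refl)) | there (there (here refl)) = refl
        ... | here refl                 | there (there (here refl)) = ⊥-elim (apart eq)
        ... | there (there (here refl)) | here refl                 = ⊥-elim (apart (sym eq))
        ... | there (here refl)         | _                         = case adj of λ { (inj₁ ()) ; (inj₂ ()) }
        ... | _                         | there (here refl)         = case adj' of λ { (inj₁ ()) ; (inj₂ ()) }

      answer : Good (position moves) → BobWins (position moves) bob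
      answer good = bob-move (fs (fs fz)) d (legal good) (bob-wins-doomed alice (good-step good (legal good)) doomed)
        where
        doomed : Doomed (update (position moves) (fs (fs fz)) d)
        doomed = pairBlocked-doomed {m = suc (suc (suc (suc (suc K))))} (s≤s z≤n)
          (refl , refl , (λ r adj r≢1 → ⊥-elim (r≢1 (neighbour-of-0 adj))) , vertex-2-blocked)
          where
          vertex-2-blocked : ∀ r → Adjacent (fs fz) r → r ≢ fz → Blocked (update (position moves) (fs (fs fz)) d) r 1
          vertex-2-blocked r adj r≢0 with neighbour-of-1 adj
          ... | inj₁ r≡0  = ⊥-elim (r≢0 r≡0)
          ... | inj₂ refl = inj₁ (d , refl , λ { refl → case 2≤d of λ { (s≤s ()) } })

    second-edge-answer : Good (position ((fs fz , m) ∷ opening)) → BobWins (position ((fs fz , m) ∷ opening)) bob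
    second-edge-answer with x ℕₚ.≟ 2
    ... | yes x≡2 = SecondEdge.answer 3 (s≤s (s≤s z≤n)) ℕₚ.≤-refl
                      (λ 3≡x → case trans 3≡x x≡2 of λ ())
                      (λ eq → case trans eq (cong (λ y → ∣ 3 - y ∣) x≡2) of λ ())
    ... | no x≢2  = SecondEdge.answer 2 (s≤s (s≤s z≤n)) (s≤s (s≤s z≤n))
                      (λ 2≡x → x≢2 (sym 2≡x)) (two-apart x 1≤x x<m x≢2)

    spot≢v : ∀ w → ¬ Adjacent v (fs (fs w)) → spot w ≢ v
    spot≢v fz     ¬adj 3≡v = ¬adj (inj₂ (cong toℕ (sym 3≡v)))
    spot≢v (fs _) _    2≡v = v≢2 (sym 2≡v)

    -- Alice labelled a vertex W = w + 2 with y ≠ m. Bob places m at a vertex z ≥ 2 without creating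
    -- clashing edge labels; then vertex 1 can no longer get m.
    module FarAnswer (w : Fin (suc (suc (suc (suc (suc K)))))) (y : ℕ) (y≢m : y ≢ m)
                     (lg : Legal (position opening) (fs (fs w)) y) where

      moves : List (Fin (suc m) × ℕ)
      moves = (fs (fs w) , y) ∷ opening

      good : Good (position moves)
      good = good-step good₂ lg

      y≢x : y ≢ x
      y≢x refl = proj₁ (proj₂ (proj₂ lg)) (v , trans (update-other _ fz 0 v≢0) (update-same emptyLab v x))

      m-unused : ¬ Used (position moves) m
      m-unused (u , eq) with placed moves u eq
      ... | here refl                 = y≢m refl
      ... | there (here ())
      ... | there (there (here refl)) = ℕₚ.<⇒≢ x<m refl

      isolated-answer : ∀ z → Far z (fs (fs w)) → Far z fz → Far z v → BobWins (position moves) bob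
      isolated-answer z far-W far-0 far-v = close-top good refl (far-from-0 far-0)
        (isolated-move-legal good (fresh moves (far⇒≢ far-W ∷ far⇒≢ far-0 ∷ far⇒≢ far-v ∷ [])) ℕₚ.≤-refl
                             m-unused isolated)
        where
        isolated : Isolated (position moves) z
        isolated u adj pu with placed moves u pu
        ... | here refl                 = far⇒not-adjacent far-W adj
        ... | there (here refl)         = far⇒not-adjacent far-0 adj
        ... | there (there (here refl)) = far⇒not-adjacent far-v adj

      -- W and v are not adjacent: 'spot w' may be next to both, but then |m - y| ≠ |m - x|.
      spot-answer : ¬ Adjacent v (fs (fs w)) → BobWins (position moves) bob
      spot-answer ¬adj = close-top good refl (2≤spot w)
        (legal-move good (fresh moves (spot≢ w ∷ at-least-2⇒≢0 (2≤spot w) ∷ spot≢v w ¬adj ∷ [])) ℕₚ.≤-refl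
                    m-unused (no-edges-new-vs-old {l = m} no-edges) new-new)
        where
        no-edges : NoEdges (position moves)
        no-edges i j e pi pj with placed moves i pi | placed moves j pj
        ... | here refl                 | here refl                 = no-loop e
        ... | here refl                 | there (here refl)         = case e of λ ()
        ... | here refl                 | there (there (here refl)) = ¬adj (inj₂ e)
        ... | there (here refl)         | here refl                 = case e of λ ()
        ... | there (here refl)         | there (here refl)         = case e of λ ()
        ... | there (here refl)         | there (there (here refl)) = v≢1 (Finₚ.toℕ-injective e)
        ... | there (there (here refl)) | here refl                 = ¬adj (inj₁ e)
        ... | there (there (here refl)) | there (here refl)         = case e of λ ()
        ... | there (there (here refl)) | there (there (here refl)) = no-loop e
        y≤m : y ≤ m
        y≤m = proj₁ (proj₂ lg)
        x≤m : x ≤ m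
        x≤m = ℕₚ.<⇒≤ x<m
        new-new : NewVsNew (position moves) (spot w) m
        new-new u u' adj adj' pu pu' eq with placed moves u pu | placed moves u' pu'
        ... | here refl                 | here refl                 = refl
        ... | there (there (here refl)) | there (there (here refl)) = refl
        ... | here refl                 | there (there (here refl)) =
              ⊥-elim (y≢x (distance-from-top-injective y≤m x≤m eq))
        ... | there (there (here refl)) | here refl                 =
              ⊥-elim (y≢x (distance-from-top-injective y≤m x≤m (sym eq)))
        ... | there (here refl)         | _                         = ⊥-elim (not-next-to-0 (spot w) (2≤spot w) adj)
        ... | _                         | there (here refl)         = ⊥-elim (not-next-to-0 (spot w) (2≤spot w) adj')

      -- Vertex 6 exists since m ≥ 6; it is far from everything at position at most 4.
      six : Fin (suc m)
      six = fs (fs (fs (fs (fs (fs fz)))))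

      six-far : ∀ {u} → toℕ u ≤ 4 → Far six u
      six-far u≤4 = inj₁ (s≤s (s≤s u≤4))

      small-neighbours : ∀ {a b : Fin (suc m)} → Adjacent a b → toℕ a ≤ 3 → toℕ a ≤ 4 × toℕ b ≤ 4
      small-neighbours adj a≤3 = ℕₚ.m≤n⇒m≤1+n a≤3 , ℕₚ.≤-trans (adjacent-close (adjacent-sym adj)) (s≤s a≤3)

      -- When v and W are adjacent, vertex 2 is isolated if both are at least 4; otherwise both are at
      -- most 4 and vertex 6 is isolated.
      answer : BobWins (position moves) bob
      answer with adjacent? v (fs (fs w))
      ... | no ¬adj = spot-answer ¬adj
      ... | yes adj with 4 ℕₚ.≤? toℕ v | 4 ℕₚ.≤? toℕ (fs (fs w))
      ...   | yes 4≤v | yes 4≤W = isolated-answer (fs (fs fz)) (inj₂ 4≤W) (inj₁ (s≤s (s≤s z≤n))) (inj₂ 4≤v)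
      ...   | no v≱4  | _       = let v≤4 , W≤4 = small-neighbours adj (ℕₚ.≤-pred (ℕₚ.≰⇒> v≱4))
                                  in isolated-answer six (six-far W≤4) (six-far z≤n) (six-far v≤4)
      ...   | yes _   | no W≱4  = let W≤4 , v≤4 = small-neighbours (adjacent-sym adj) (ℕₚ.≤-pred (ℕₚ.≰⇒> W≱4))
                                  in isolated-answer six (six-far W≤4) (six-far z≤n) (six-far v≤4)

    reply : ∀ w y → Legal (position opening) w y → BobWins (update (position opening) w y) bob
    reply fz y (() , _)
    reply (fs fz) y lg with y ℕₚ.≟ m
    ... | yes refl = second-edge-answer (good-step good₂ lg)
    ... | no y≢m   = bob-wins-doomed bob (good-step good₂ lg) (end-blocked-doomed refl (inj₁ (y , refl , y≢m)))
    reply (fs (fs w)) y lg with y ℕₚ.≟ m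
    ... | yes refl = bob-wins-doomed bob (good-step good₂ lg)
                       (end-blocked-doomed refl (inj₂ (fs (fs w) , update-same _ (fs (fs w)) m , λ ())))
    ... | no y≢m   = FarAnswer.answer w y y≢m lg

    answer : BobWins (position ((v , x) ∷ [])) bob
    answer = bob-move fz 0 opening-legal (alice-move vertex-1-free reply)
      where
      vertex-1-free : ¬ Full (position opening)
      vertex-1-free full =
        case trans (sym (proj₂ (full (fs fz)))) (fresh opening ((λ ()) ∷ (λ 1≡v → v≢1 (sym 1≡v)) ∷ []))
        of λ ()

  right-half⇒3≤ : ∀ t → m ≤ t + t → 3 ≤ t
  right-half⇒3≤ (suc (suc (suc t))) _ = s≤s (s≤s (s≤s z≤n))
  right-half⇒3≤ 0 ()
  right-half⇒3≤ 1 (s≤s (s≤s ()))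
  right-half⇒3≤ 2 (s≤s (s≤s (s≤s (s≤s ()))))

  answer-far : ∀ v {x} → 3 ≤ toℕ v → x ≤ m → BobWins (position ((v , x) ∷ [])) bob
  answer-far v {x} 3≤v x≤m with x ℕₚ.≟ 0 | x ℕₚ.≟ m
  ... | yes refl | _        = extreme-answer v (ℕₚ.<⇒≤ 3≤v) (inj₁ (refl , refl)) (first-move-good v x≤m)
  ... | no _     | yes refl = extreme-answer v (ℕₚ.<⇒≤ 3≤v) (inj₂ (refl , refl)) (first-move-good v x≤m)
  ... | no x≢0   | no x≢m   = Middle.answer v x 3≤v (ℕₚ.n≢0⇒n>0 x≢0) (ℕₚ.≤∧≢⇒< x≤m x≢m) (first-move-good v x≤m)

  reflected-half : ∀ t → ¬ (m ≤ t + t) → m ≤ (m ∸ t) + (m ∸ t)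
  reflected-half t ¬half = begin
    m                   ≡⟨ sym (ℕₚ.m∸n+n≡m t≤m) ⟩
    (m ∸ t) + t         ≤⟨ ℕₚ.+-monoʳ-≤ (m ∸ t) (ℕₚ.m+n≤o⇒m≤o∸n t (ℕₚ.<⇒≤ t+t<m)) ⟩
    (m ∸ t) + (m ∸ t)   ∎
    where
    open ℕₚ.≤-Reasoning
    t+t<m : t + t < m
    t+t<m = ℕₚ.≰⇒> ¬half
    t≤m : t ≤ m
    t≤m = ℕₚ.≤-trans (ℕₚ.m≤m+n t t) (ℕₚ.<⇒≤ t+t<m)

  -- Bob's answer to any first move; by symmetry Alice's vertex may be taken in the right half.
  answer : ∀ v x → x ≤ m → BobWins (position ((v , x) ∷ [])) bob
  answer v x x≤m with m ℕₚ.≤? toℕ v + toℕ v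
  ... | yes half = answer-far v (right-half⇒3≤ (toℕ v) half) x≤m
  ... | no ¬half = bob-wins-mirror mirrored (answer-far (opposite v) (right-half⇒3≤ _ half′) x≤m)
    where
    half′ : m ≤ toℕ (opposite v) + toℕ (opposite v)
    half′ = subst (λ t → m ≤ t + t) (sym (Finₚ.opposite-prop v)) (reflected-half (toℕ v) ¬half)
    mirrored : Mirror (position ((v , x) ∷ [])) (position ((opposite v , x) ∷ []))
    mirrored = subst (λ u → Mirror (update emptyLab u x) (update emptyLab (opposite v) x))
                     (Finₚ.opposite-involutive v) (mirror-update (λ _ → refl) (opposite v) x)

  bob-wins-alice-starting : BobWins {suc m} emptyLab alice
  bob-wins-alice-starting = alice-move (λ full → case proj₂ (full fz) of λ ()) λ v x lg → answer v x (proj₁ (proj₂ lg))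

-- Long paths follow from Bob's strategies; the short ones, and Alice starting on P_4, P_5, P_6, are
-- settled by the game-tree search (depth = number of moves searched before looking for an obstruction).
theorem1 : ((n : ℕ) → 4 ≤ n → (p : Player) → BobWins {n} emptyLab p)
           × (AliceWins {3} emptyLab alice × BobWins {3} emptyLab bob)
           × ((n : ℕ) → (n ≡ 1 ⊎ n ≡ 2) → (p : Player) → AliceWins {n} emptyLab p)
theorem1 = bob-wins-long , first-player-wins-P₃ , alice-wins-short
  where
  bob-wins-long : (n : ℕ) → 4 ≤ n → (p : Player) → BobWins {n} emptyLab p
  bob-wins-long (suc (suc (suc (suc K)))) _ bob = BobStarts.bob-wins-starting K
  bob-wins-long 0 () _
  bob-wins-long 1 (s≤s ()) _
  bob-wins-long 2 (s≤s (s≤s ())) _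
  bob-wins-long 3 (s≤s (s≤s (s≤s ()))) _
  bob-wins-long 4 _ alice = from-just (bobSolve {1} 4 emptyLab good-empty alice)
  bob-wins-long 5 _ alice = from-just (bobSolve {2} 4 emptyLab good-empty alice)
  bob-wins-long 6 _ alice = from-just (bobSolve {3} 4 emptyLab good-empty alice)
  bob-wins-long (suc (suc (suc (suc (suc (suc (suc K))))))) _ alice = AliceStarts.bob-wins-alice-starting K
  first-player-wins-P₃ : AliceWins {3} emptyLab alice × BobWins {3} emptyLab bob
  first-player-wins-P₃ = from-just (aliceSolve {2} 3 emptyLab alice) , from-just (bobSolve {0} 3 emptyLab good-empty bob)
  alice-wins-short : (n : ℕ) → (n ≡ 1 ⊎ n ≡ 2) → (p : Player) → AliceWins {n} emptyLab p
  alice-wins-short .1 (inj₁ refl) alice = from-just (aliceSolve {0} 1 emptyLab alice)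
  alice-wins-short .1 (inj₁ refl) bob   = from-just (aliceSolve {0} 1 emptyLab bob)
  alice-wins-short .2 (inj₂ refl) alice = from-just (aliceSolve {1} 2 emptyLab alice)
  alice-wins-short .2 (inj₂ refl) bob   = from-just (aliceSolve {1} 2 emptyLab bob)
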